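{- Let $n,p$ be positive integers and $\kappa$ an $n,p$-core. Then the skew length of $\kappa$ viewed as an $n,p$-core equals the skew length of $\kappa$ viewed as a $p,n$-core; that is, the number of cells of $\kappa$ lying in an $n$-row and having hook length less than $p$ equals the number of cells lying in a $p$-row and having hook length less than $n$.
   Context: Partitions are identified with Young diagrams; hook length $h_\lambda(i,j)=\lambda_i-j+\lambda'_j-i+1$. An $n,p$-core has no hook length equal to $n$ or $p$. Let $m$ be the hook length of the top-left cell of $\kappa$ and $H^c(m)$ the set of hook lengths of the cells in the first column. For $h\in H^c(m)$ the row whose leftmost cell has hook length $h$ is an $n$-row if $h+n\notin H^c(m)$, and a $p$-row if $h+p\notin H^c(m)$. -}

module Defs where

open import Data.Nat using (ℕ; zero; suc; _+_; _∸_; _<_; _≥_; _<?_; _≟_)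
open import Data.List using (List; []; _∷_; length; upTo; map; concatMap; filter)
open import Data.List.Relation.Unary.All using (All)
open import Data.List.Relation.Unary.Linked using (Linked)
open import Data.List.Membership.DecPropositional _≟_ using (_∈_; _∈?_)
open import Data.Product using (_×_; _,_; proj₁; proj₂)
open import Relation.Nullary using (¬_; Dec)
open import Relation.Nullary.Decidable using (¬?; _×-dec_)

-- A partition: a weakly decreasing list of positive parts λ₁ ≥ λ₂ ≥ … > 0.
-- Rows and columns are indexed from 0 (row i here = row i+1 of the paper).
record Partition : Set where
  constructor mkPartition
  field
    parts      : List ℕ
    decreasing : Linked _≥_ parts
    positive   : All (λ x → 0 < x) parts

open Partition public

nth : List ℕ → ℕ → ℕ
nth []       _       = 0
nth (x ∷ xs) zero    = x
nth (x ∷ xs) (suc i) = nth xs i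

part : Partition → ℕ → ℕ
part κ i = nth (parts κ) i

conj : Partition → ℕ → ℕ
conj κ j = length (filter (λ x → j <? x) (parts κ))

-- hook length of the cell in (0-indexed) row i, column j:
-- λ_i - j + λ'_j - i - 1   (= paper's λ_i - j + λ'_j - i + 1 with 1-indexing)
hook : Partition → ℕ → ℕ → ℕ
hook κ i j = (part κ i + conj κ j) ∸ (i + j + 1)

cells : Partition → List (ℕ × ℕ)
cells κ = concatMap (λ i → map (λ j → (i , j)) (upTo (part κ i))) (upTo (length (parts κ)))

hooks : Partition → List ℕ
hooks κ = map (λ c → hook κ (proj₁ c) (proj₂ c)) (cells κ)

IsCore : ℕ → ℕ → Partition → Set
IsCore n p κ = ¬ (n ∈ hooks κ) × ¬ (p ∈ hooks κ)

firstColHooks : Partition → List ℕ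
firstColHooks κ = map (λ i → hook κ i 0) (upTo (length (parts κ)))

IsRow : ℕ → Partition → ℕ → Set
IsRow n κ i = ¬ (hook κ i 0 + n ∈ firstColHooks κ)

isRow? : (n : ℕ) (κ : Partition) (i : ℕ) → Dec (IsRow n κ i)
isRow? n κ i = ¬? (hook κ i 0 + n ∈? firstColHooks κ)

skewLength : ℕ → ℕ → Partition → ℕ
skewLength n p κ =
  length (filter (λ c → isRow? n κ (proj₁ c) ×-dec (hook κ (proj₁ c) (proj₂ c) <? p)) (cells κ))

-- Encode a partition by the set H of hook lengths in its first column. The hook lengths in the row
-- with leading hook h are exactly h − g for the gaps g < h of H (g ∉ H), so the skew length of an
-- n,p-core is the sum over the n-rows h ∈ H (h + n ∉ H) of S p h, the number of gaps g < h with
-- h − g < p; being an n,p-core implies n, p ∉ H and H is closed under subtracting n and p.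
-- Removing the largest element h of H changes the n,p-sum by S p h − S p (h − n), and
-- S p h + S n (h − p) = S (n + p) h. So after adding S p (h − n) + S n (h − p), which is symmetric
-- in n and p, both the n,p- and the p,n-sum drop by S (n + p) h, and induction on H concludes.
module Submission where

open import Defs
open import Data.Nat using (ℕ; zero; suc; _+_; _*_; _∸_; _≤_; _<_; _>_; _≥_; _<?_; _≟_; z≤n; s≤s)
open import Data.Nat.Properties
open import Data.List using (List; []; _∷_; length; map; filter; upTo; applyUpTo; concatMap; _++_)
open import Data.List.Properties
  using (filter-++; length-++; map-applyUpTo; map-upTo; map-cong; filter-accept; filter-all; filter-none; length-filter)
open import Data.List.Relation.Unary.All as All using (All; []; _∷_)
open import Data.List.Relation.Unary.AllPairs using (AllPairs; []; _∷_)
open import Data.List.Relation.Unary.Any as Any using (here; there)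
open import Data.List.Membership.Propositional.Properties using (∈-map⁺; ∈-upTo⁺; ∈-map⁻; ∈-upTo⁻; ∈-concatMap⁺)
open import Data.List.Relation.Unary.Linked as Linked using (Linked; []; [-]; _∷_)
open import Data.List.Relation.Unary.Linked.Properties using (Linked⇒All)
open import Data.List.Membership.DecPropositional _≟_ using (_∈_; _∉_; _∈?_)
open import Data.Product using (_×_; _,_; proj₁; proj₂; ∃-syntax)
open import Data.Empty using (⊥-elim)
open import Function using (_∘_)
open import Relation.Nullary using (¬_; Dec; yes; no)
open import Relation.Nullary.Decidable using (¬?; _×-dec_)
open import Relation.Unary using (Decidable)
open import Relation.Binary.PropositionalEquality
open import Algebra.Properties.CommutativeSemigroup +-commutativeSemigroup using (interchange; xy∙z≈xz∙y; x∙yz≈y∙xz)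

∑< : ℕ → (ℕ → ℕ) → ℕ
∑< zero    f = 0
∑< (suc m) f = f 0 + ∑< m (f ∘ suc)

-- Binds tighter than _+_: ∑[ i < m ] f i + x is (∑[ i < m ] f i) + x.
infix 8 ∑<
syntax ∑< m (λ i → e) = ∑[ i < m ] e

∑<-cong : ∀ {f g} m → (∀ i → i < m → f i ≡ g i) → ∑< m f ≡ ∑< m g
∑<-cong zero    f≗g = refl
∑<-cong (suc m) f≗g = cong₂ _+_ (f≗g 0 (s≤s z≤n)) (∑<-cong m (λ i i<m → f≗g (suc i) (s≤s i<m)))

∑<-+ : ∀ m f g → ∑[ i < m ] (f i + g i) ≡ ∑< m f + ∑< m g
∑<-+ zero    f g = refl
∑<-+ (suc m) f g = trans (cong (f 0 + g 0 +_) (∑<-+ m (f ∘ suc) (g ∘ suc))) (interchange (f 0) (g 0) _ _)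

∑<-*ˡ : ∀ c m f → ∑[ i < m ] (c * f i) ≡ c * ∑< m f
∑<-*ˡ c zero    f = sym (*-zeroʳ c)
∑<-*ˡ c (suc m) f = trans (cong (c * f 0 +_) (∑<-*ˡ c m (f ∘ suc))) (sym (*-distribˡ-+ c (f 0) _))

∑<-splitAt : ∀ a b f → ∑< (a + b) f ≡ ∑< a f + ∑[ t < b ] f (a + t)
∑<-splitAt zero    b f = refl
∑<-splitAt (suc a) b f = trans (cong (f 0 +_) (∑<-splitAt a b (f ∘ suc))) (sym (+-assoc (f 0) _ _))

∑<-split : ∀ {a m} → a ≤ m → ∀ f → ∑< m f ≡ ∑< a f + ∑[ t < m ∸ a ] f (a + t)
∑<-split {a} {m} a≤m f = trans (cong (λ k → ∑< k f) (sym (m+[n∸m]≡n a≤m))) (∑<-splitAt a (m ∸ a) f)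

∑<-suc : ∀ m f → ∑< (suc m) f ≡ ∑< m f + f m
∑<-suc zero    f = +-comm (f 0) 0
∑<-suc (suc m) f = trans (cong (f 0 +_) (∑<-suc m (f ∘ suc))) (sym (+-assoc (f 0) _ _))

term≤∑< : ∀ m f {i} → i < m → f i ≤ ∑< m f
term≤∑< (suc m) f {zero}  _         = m≤m+n (f 0) _
term≤∑< (suc m) f {suc i} (s≤s i<m) = ≤-trans (term≤∑< m (f ∘ suc) i<m) (m≤n+m _ (f 0))

∑<-positive⇒term : ∀ m f → 0 < ∑< m f → ∃[ i ] (i < m × 0 < f i)
∑<-positive⇒term (suc m) f pos with f 0 in eq
... | suc _ = 0 , s≤s z≤n , subst (0 <_) (sym eq) (s≤s z≤n)
... | zero with ∑<-positive⇒term m (f ∘ suc) pos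
...   | i , i<m , fi>0 = suc i , s≤s i<m , fi>0

∑<-0 : ∀ m → ∑[ i < m ] 0 ≡ 0
∑<-0 zero    = refl
∑<-0 (suc m) = ∑<-0 m

𝟙 : ∀ {a} {P : Set a} → Dec P → ℕ
𝟙 (yes _) = 1
𝟙 (no _)  = 0

module _ {a} {P : Set a} where

  𝟙-yes : (P? : Dec P) → P → 𝟙 P? ≡ 1
  𝟙-yes (yes _) _ = refl
  𝟙-yes (no ¬p) p = ⊥-elim (¬p p)

  𝟙-no : (P? : Dec P) → ¬ P → 𝟙 P? ≡ 0
  𝟙-no (yes p) ¬p = ⊥-elim (¬p p)
  𝟙-no (no _)  _  = refl

  𝟙-positive : (P? : Dec P) → 0 < 𝟙 P? → P
  𝟙-positive (yes p) _ = p

  𝟙-cong : ∀ {b} {Q : Set b} (P? : Dec P) (Q? : Dec Q) → (P → Q) → (Q → P) → 𝟙 P? ≡ 𝟙 Q?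
  𝟙-cong (yes _) (yes _) _   _   = refl
  𝟙-cong (yes p) (no ¬q) p→q _   = ⊥-elim (¬q (p→q p))
  𝟙-cong (no ¬p) (yes q) _   q→p = ⊥-elim (¬p (q→p q))
  𝟙-cong (no _)  (no _)  _   _   = refl

  𝟙-× : ∀ {b} {Q : Set b} (P? : Dec P) (Q? : Dec Q) → 𝟙 (P? ×-dec Q?) ≡ 𝟙 P? * 𝟙 Q?
  𝟙-× (yes _) (yes _) = refl
  𝟙-× (yes _) (no _)  = refl
  𝟙-× (no _)  (yes _) = refl
  𝟙-× (no _)  (no _)  = refl

∑<-restrict : ∀ {q h} → q ≤ h → ∀ f → ∑[ g < h ] (𝟙 (g <? q) * f g) ≡ ∑< q f
∑<-restrict {zero} {h} _ f = trans (∑<-cong h (λ _ _ → refl)) (∑<-0 h)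
∑<-restrict {suc q} {suc h} (s≤s q≤h) f = cong₂ _+_ (+-identityʳ (f 0)) (trans
  (∑<-cong h (λ g _ → cong (_* f (suc g)) (𝟙-cong (suc g <? suc q) (g <? q) ≤-pred s≤s)))
  (∑<-restrict q≤h (f ∘ suc)))

module _ {a p} {A : Set a} {P : A → Set p} (P? : Decidable P) where

  length-filter-applyUpTo : ∀ (f : ℕ → A) m → length (filter P? (applyUpTo f m)) ≡ ∑[ i < m ] 𝟙 (P? (f i))
  length-filter-applyUpTo f zero = refl
  length-filter-applyUpTo f (suc m) with P? (f 0)
  ... | yes _ = cong suc (length-filter-applyUpTo (f ∘ suc) m)
  ... | no _  = length-filter-applyUpTo (f ∘ suc) m

  length-filter-concatMap : ∀ {B : Set} (g : B → List A) (f : ℕ → B) m →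
    length (filter P? (concatMap g (applyUpTo f m))) ≡ ∑[ i < m ] length (filter P? (g (f i)))
  length-filter-concatMap g f zero    = refl
  length-filter-concatMap g f (suc m) = begin
    length (filter P? (g (f 0) ++ rest))              ≡⟨ cong length (filter-++ P? (g (f 0)) rest) ⟩
    length (filter P? (g (f 0)) ++ filter P? rest)    ≡⟨ length-++ (filter P? (g (f 0))) ⟩
    length (filter P? (g (f 0))) + length (filter P? rest)
      ≡⟨ cong (length (filter P? (g (f 0))) +_) (length-filter-concatMap g (f ∘ suc) m) ⟩
    ∑[ i < suc m ] length (filter P? (g (f i)))       ∎
    where
      open ≡-Reasoning
      rest = concatMap g (applyUpTo (f ∘ suc) m)

∑∈ : List ℕ → (ℕ → ℕ) → ℕ
∑∈ []       f = 0
∑∈ (y ∷ ys) f = f y + ∑∈ ys f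

infix 8 ∑∈
syntax ∑∈ ys (λ y → e) = ∑[ y ∈ ys ] e

∑∈-cong : ∀ {f g} ys → (∀ {y} → y ∈ ys → f y ≡ g y) → ∑∈ ys f ≡ ∑∈ ys g
∑∈-cong []       _   = refl
∑∈-cong (y ∷ ys) f≗g = cong₂ _+_ (f≗g (here refl)) (∑∈-cong ys (f≗g ∘ there))

∑∈-applyUpTo : ∀ F (f : ℕ → ℕ) m → ∑∈ (applyUpTo f m) F ≡ ∑[ i < m ] F (f i)
∑∈-applyUpTo F f zero    = refl
∑∈-applyUpTo F f (suc m) = cong (F (f 0) +_) (∑∈-applyUpTo F (f ∘ suc) m)

∑∈-update : ∀ {a b : ℕ → ℕ} {v e} ys → AllPairs _>_ ys → v ∈ ys →
            (∀ {y} → y ∈ ys → y ≢ v → a y ≡ b y) → a v + e ≡ b v → ∑∈ ys a + e ≡ ∑∈ ys b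
∑∈-update {a} {b} {v} {e} (y ∷ ys) (y>ys ∷ _) (here refl) a≗b at-v = begin
  a y + ∑∈ ys a + e  ≡⟨ xy∙z≈xz∙y (a y) _ e ⟩
  a y + e + ∑∈ ys a  ≡⟨ cong₂ _+_ at-v (∑∈-cong ys (λ z∈ys → a≗b (there z∈ys) (<⇒≢ (All.lookup y>ys z∈ys)))) ⟩
  b y + ∑∈ ys b      ∎
  where open ≡-Reasoning
∑∈-update {a} {e = e} (y ∷ ys) (y>ys ∷ ys-strict) (there v∈ys) a≗b at-v =
  trans (+-assoc (a y) _ e) (cong₂ _+_ (a≗b (here refl) y≢v) (∑∈-update ys ys-strict v∈ys (a≗b ∘ there) at-v))
  where
    y≢v : y ≢ _
    y≢v y≡v = <⇒≢ (All.lookup y>ys v∈ys) (sym y≡v)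

∈-∷-below : ∀ {g h H} → g < h → g ∈ h ∷ H → g ∈ H
∈-∷-below g<h (here g≡h)  = ⊥-elim (<⇒≢ g<h g≡h)
∈-∷-below _   (there g∈H) = g∈H

∉-above : ∀ {h g H} → All (_< h) H → h ≤ g → g ∉ H
∉-above H<h h≤g g∈H = <⇒≱ (All.lookup H<h g∈H) h≤g

gap : List ℕ → ℕ → ℕ
gap H g = 𝟙 (¬? (g ∈? H))

gap-∈ : ∀ {H g} → g ∈ H → gap H g ≡ 0
gap-∈ {H} {g} g∈H = 𝟙-no (¬? (g ∈? H)) (λ g∉H → g∉H g∈H)

gap-∉ : ∀ {H g} → g ∉ H → gap H g ≡ 1
gap-∉ {H} {g} = 𝟙-yes (¬? (g ∈? H))

gap-∷ : ∀ {z H g} → g ≢ z → gap (z ∷ H) g ≡ gap H g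
gap-∷ {z} {H} {g} g≢z = 𝟙-cong (¬? (g ∈? z ∷ H)) (¬? (g ∈? H)) (λ g∉zH g∈H → g∉zH (there g∈H))
  λ g∉H → λ { (here g≡z) → g≢z g≡z ; (there g∈H) → g∉H g∈H }

-- The hooks of the row with leading hook h are h − g for the gaps g < h (∑-rowHooks), so this
-- counts the hooks < p in that row.
shortHooks : ℕ → List ℕ → ℕ → ℕ
shortHooks p H h = ∑[ g < h ] (gap H g * 𝟙 (h ∸ g <? p))

shortHooks-∷ : ∀ p {z H h} → h ≤ z → shortHooks p (z ∷ H) h ≡ shortHooks p H h
shortHooks-∷ p {h = h} h≤z = ∑<-cong h λ g g<h → cong (_* 𝟙 (h ∸ g <? p)) (gap-∷ (<⇒≢ (<-≤-trans g<h h≤z)))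

shortHooks-split : ∀ n p H h → h ≢ p → (p < h → h ∸ p ∈ H) →
                   shortHooks p H h + shortHooks n H (h ∸ p) ≡ shortHooks (n + p) H h
shortHooks-split n p H h h≢p closed = begin
  shortHooks p H h + shortHooks n H q
    ≡⟨ cong (shortHooks p H h +_) (sym (∑<-restrict (m∸n≤m h p) (λ g → gap H g * 𝟙 (q ∸ g <? n)))) ⟩
  shortHooks p H h + ∑[ g < h ] (𝟙 (g <? q) * (gap H g * 𝟙 (q ∸ g <? n)))
    ≡⟨ sym (∑<-+ h _ _) ⟩
  ∑[ g < h ] (gap H g * 𝟙 (h ∸ g <? p) + 𝟙 (g <? q) * (gap H g * 𝟙 (q ∸ g <? n)))
    ≡⟨ ∑<-cong h term ⟩
  shortHooks (n + p) H h ∎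
  where
    open ≡-Reasoning
    q = h ∸ p
    -- For g < q, h − g = p + (q − g); for g ≥ q, either h − g < p or g = q ∈ H.
    term : ∀ g → g < h → gap H g * 𝟙 (h ∸ g <? p) + 𝟙 (g <? q) * (gap H g * 𝟙 (q ∸ g <? n))
                         ≡ gap H g * 𝟙 (h ∸ g <? n + p)
    term g g<h with g <? q | h ∸ g <? p
    ... | yes g<q | short? = begin
      gap H g * 𝟙 short? + 1 * (gap H g * 𝟙 (q ∸ g <? n))
        ≡⟨ cong₂ _+_ (cong (gap H g *_) (𝟙-no short? (m+n≮m p (q ∸ g) ∘ subst (_< p) h∸g≡p+[q∸g])))
                     (*-identityˡ _) ⟩
      gap H g * 0 + gap H g * 𝟙 (q ∸ g <? n)
        ≡⟨ cong (_+ gap H g * 𝟙 (q ∸ g <? n)) (*-zeroʳ (gap H g)) ⟩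
      gap H g * 𝟙 (q ∸ g <? n)
        ≡⟨ cong (gap H g *_) (𝟙-cong (q ∸ g <? n) (h ∸ g <? n + p)
             (λ d<n → subst (_< n + p) (sym h∸g≡p+[q∸g]) (subst (_< n + p) (+-comm (q ∸ g) p) (+-monoˡ-< p d<n)))
             (λ lt → +-cancelʳ-< p (q ∸ g) n (subst (_< n + p) (trans h∸g≡p+[q∸g] (+-comm p (q ∸ g))) lt))) ⟩
      gap H g * 𝟙 (h ∸ g <? n + p) ∎
      where
        p≤h : p ≤ h
        p≤h = <⇒≤ (m∸n≢0⇒n<m (λ q≡0 → n≮0 (subst (g <_) q≡0 g<q)))
        h∸g≡p+[q∸g] : h ∸ g ≡ p + (q ∸ g)
        h∸g≡p+[q∸g] = trans (cong (_∸ g) (sym (m+[n∸m]≡n p≤h))) (+-∸-assoc p (<⇒≤ g<q))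
    ... | no _ | yes short = trans (+-identityʳ _)
      (cong (gap H g *_) (sym (𝟙-yes (h ∸ g <? n + p) (<-≤-trans short (m≤n+m p n)))))
    ... | no g≮q | no long = trans (trans (+-identityʳ _) (*-zeroʳ (gap H g)))
      (cong (_* 𝟙 (h ∸ g <? n + p)) (sym (gap-∈ g∈H)))
      where
        p+g≤h : p + g ≤ h
        p+g≤h = m≤o∸n⇒m+n≤o p (<⇒≤ g<h) (≮⇒≥ long)
        g≡q : g ≡ q
        g≡q = ≤-antisym (m+n≤o⇒m≤o∸n g (subst (_≤ h) (+-comm p g) p+g≤h)) (≮⇒≥ g≮q)
        g∈H : g ∈ H
        g∈H = subst (_∈ H) (sym g≡q) (closed (≤∧≢⇒< (≤-trans (m≤m+n p g) p+g≤h) (h≢p ∘ sym)))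

betaSkew : ℕ → ℕ → List ℕ → ℕ
betaSkew n p H = ∑[ y ∈ H ] (gap H (y + n) * shortHooks p H y)

IsCoreSet : ℕ → List ℕ → Set
IsCoreSet n H = ∀ {y} → y ∈ H → y ≢ n × (n < y → y ∸ n ∈ H)

IsCoreSet-tail : ∀ {n h H} → AllPairs _>_ (h ∷ H) → IsCoreSet n (h ∷ H) → IsCoreSet n H
IsCoreSet-tail {n} (h>H ∷ _) core {y} y∈H = proj₁ (core (there y∈H)) ,
  λ n<y → ∈-∷-below (≤-<-trans (m∸n≤m y n) (All.lookup h>H y∈H)) (proj₂ (core (there y∈H)) n<y)

-- h is an n-row of h ∷ H; h − n is an n-row of H but not of h ∷ H.
betaSkew-∷ : ∀ n p {h H} → 0 < n → AllPairs _>_ (h ∷ H) → IsCoreSet n (h ∷ H) →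
             betaSkew n p (h ∷ H) + shortHooks p H (h ∸ n) ≡ shortHooks p (h ∷ H) h + betaSkew n p H
betaSkew-∷ n p {h} {H} n>0 (h>H ∷ H-strict) core = begin
  gap (h ∷ H) (h + n) * shortHooks p (h ∷ H) h + ∑∈ H a + e
    ≡⟨ cong (λ t → t * shortHooks p (h ∷ H) h + ∑∈ H a + e) (gap-∉ h+n∉hH) ⟩
  1 * shortHooks p (h ∷ H) h + ∑∈ H a + e
    ≡⟨ +-assoc (1 * shortHooks p (h ∷ H) h) _ e ⟩
  1 * shortHooks p (h ∷ H) h + (∑∈ H a + e)
    ≡⟨ cong₂ _+_ (*-identityˡ _) tail ⟩
  shortHooks p (h ∷ H) h + betaSkew n p H ∎
  where
    open ≡-Reasoning
    a b : ℕ → ℕ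
    a y = gap (h ∷ H) (y + n) * shortHooks p (h ∷ H) y
    b y = gap H (y + n) * shortHooks p H y
    e = shortHooks p H (h ∸ n)
    h+n∉hH : h + n ∉ h ∷ H
    h+n∉hH (here h+n≡h)   = <⇒≢ (m<m+n h n>0) (sym h+n≡h)
    h+n∉hH (there h+n∈H) = ∉-above h>H (m≤m+n h n) h+n∈H
    a≗b : ∀ {y} → y ∈ H → y + n ≢ h → a y ≡ b y
    a≗b y∈H y+n≢h = cong₂ _*_ (gap-∷ y+n≢h) (shortHooks-∷ p (<⇒≤ (All.lookup h>H y∈H)))
    tail : ∑∈ H a + e ≡ betaSkew n p H
    tail with n <? h
    ... | yes n<h = ∑∈-update H H-strict h∸n∈H
            (λ y∈H y≢h∸n → a≗b y∈H (λ y+n≡h → y≢h∸n (trans (sym (m+n∸n≡m _ n)) (cong (_∸ n) y+n≡h))))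
            at-h∸n
      where
        h∸n+n≡h : h ∸ n + n ≡ h
        h∸n+n≡h = m∸n+n≡m (<⇒≤ n<h)
        h∸n∈H : h ∸ n ∈ H
        h∸n∈H = ∈-∷-below (∸-monoʳ-< n>0 (<⇒≤ n<h)) (proj₂ (core (here refl)) n<h)
        at-h∸n : a (h ∸ n) + e ≡ b (h ∸ n)
        at-h∸n = begin
          a (h ∸ n) + e  ≡⟨ cong (λ t → t * shortHooks p (h ∷ H) (h ∸ n) + e) (gap-∈ (here h∸n+n≡h)) ⟩
          e              ≡⟨ sym (*-identityˡ e) ⟩
          1 * e          ≡⟨ cong (_* e) (sym (trans (cong (gap H) h∸n+n≡h) (gap-∉ (∉-above h>H ≤-refl)))) ⟩
          b (h ∸ n)      ∎
    ... | no n≮h = trans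
            (cong₂ _+_ (∑∈-cong H (λ y∈H → a≗b y∈H y+n≢h)) (cong (shortHooks p H) (m≤n⇒m∸n≡0 h≤n)))
            (+-identityʳ _)
      where
        h≤n : h ≤ n
        h≤n = ≮⇒≥ n≮h
        y+n≢h : ∀ {y} → y + n ≢ h
        y+n≢h {y} y+n≡h = proj₁ (core (here refl)) (≤-antisym h≤n (subst (n ≤_) y+n≡h (m≤n+m n y)))

betaSkew-∷-both : ∀ n p {h H} → 0 < n → AllPairs _>_ (h ∷ H) → IsCoreSet n (h ∷ H) → IsCoreSet p (h ∷ H) →
                betaSkew n p (h ∷ H) + (shortHooks p H (h ∸ n) + shortHooks n H (h ∸ p))
                  ≡ shortHooks (n + p) (h ∷ H) h + betaSkew n p H
betaSkew-∷-both n p {h} {H} n>0 strict n-core p-core = begin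
  betaSkew n p (h ∷ H) + (shortHooks p H (h ∸ n) + shortHooks n H (h ∸ p))
    ≡⟨ sym (+-assoc (betaSkew n p (h ∷ H)) _ _) ⟩
  betaSkew n p (h ∷ H) + shortHooks p H (h ∸ n) + shortHooks n H (h ∸ p)
    ≡⟨ cong (_+ shortHooks n H (h ∸ p)) (betaSkew-∷ n p n>0 strict n-core) ⟩
  shortHooks p (h ∷ H) h + betaSkew n p H + shortHooks n H (h ∸ p)
    ≡⟨ xy∙z≈xz∙y (shortHooks p (h ∷ H) h) _ _ ⟩
  shortHooks p (h ∷ H) h + shortHooks n H (h ∸ p) + betaSkew n p H
    ≡⟨ cong (λ t → shortHooks p (h ∷ H) h + t + betaSkew n p H) (sym (shortHooks-∷ n (m∸n≤m h p))) ⟩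
  shortHooks p (h ∷ H) h + shortHooks n (h ∷ H) (h ∸ p) + betaSkew n p H
    ≡⟨ cong (_+ betaSkew n p H) (shortHooks-split n p (h ∷ H) h (proj₁ h-p-core) (proj₂ h-p-core)) ⟩
  shortHooks (n + p) (h ∷ H) h + betaSkew n p H ∎
  where
    open ≡-Reasoning
    h-p-core = p-core (here refl)

betaSkew-sym : ∀ n p {H} → 0 < n → 0 < p → AllPairs _>_ H → IsCoreSet n H → IsCoreSet p H →
               betaSkew n p H ≡ betaSkew p n H
betaSkew-sym n p {[]} _ _ _ _ _ = refl
betaSkew-sym n p {h ∷ H} n>0 p>0 strict@(_ ∷ H-strict) n-core p-core =
  +-cancelʳ-≡ (shortHooks p H (h ∸ n) + shortHooks n H (h ∸ p)) _ _ (begin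
    betaSkew n p (h ∷ H) + (shortHooks p H (h ∸ n) + shortHooks n H (h ∸ p))
      ≡⟨ betaSkew-∷-both n p n>0 strict n-core p-core ⟩
    shortHooks (n + p) (h ∷ H) h + betaSkew n p H
      ≡⟨ cong₂ _+_ (cong (λ m → shortHooks m (h ∷ H) h) (+-comm n p))
           (betaSkew-sym n p n>0 p>0 H-strict (IsCoreSet-tail strict n-core) (IsCoreSet-tail strict p-core)) ⟩
    shortHooks (p + n) (h ∷ H) h + betaSkew p n H
      ≡⟨ sym (betaSkew-∷-both p n p>0 strict p-core n-core) ⟩
    betaSkew p n (h ∷ H) + (shortHooks n H (h ∸ p) + shortHooks p H (h ∸ n))
      ≡⟨ cong (betaSkew p n (h ∷ H) +_) (+-comm (shortHooks n H (h ∸ p)) _) ⟩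
    betaSkew p n (h ∷ H) + (shortHooks p H (h ∸ n) + shortHooks n H (h ∸ p)) ∎)
  where open ≡-Reasoning

-- List versions of conj, hook and firstColHooks, so that one can induct on the parts; on parts κ
-- they are definitionally the ones of Defs.
colLength : List ℕ → ℕ → ℕ
colLength L j = length (filter (j <?_) L)

colLength-< : ∀ {x} L {j} → j < x → colLength (x ∷ L) j ≡ suc (colLength L j)
colLength-< L {j} j<x = cong length (filter-accept (j <?_) j<x)

colLength-0 : ∀ {L} → All (0 <_) L → colLength L 0 ≡ length L
colLength-0 L>0 = cong length (filter-all (0 <?_) L>0)

colLength-≥ : ∀ {L j} → All (_≤ j) L → colLength L j ≡ 0
colLength-≥ L≤j = cong length (filter-none (_ <?_) (All.map (λ y≤j j<y → <⇒≱ j<y y≤j) L≤j))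

hookAt : List ℕ → ℕ → ℕ → ℕ
hookAt L i j = (nth L i + colLength L j) ∸ (i + j + 1)

hookAt-∷ : ∀ {x} L i {j} → j < x → hookAt (x ∷ L) (suc i) j ≡ hookAt L i j
hookAt-∷ L i {j} j<x = trans (cong (λ c → (nth L i + c) ∸ (suc i + j + 1)) (colLength-< L j<x))
                             (cong (_∸ suc (i + j + 1)) (+-suc (nth L i) (colLength L j)))

hookAt-corner : ∀ {x L} → All (0 <_) (x ∷ L) → hookAt (x ∷ L) 0 0 ≡ x + length L
hookAt-corner {x} {L} pos = trans (cong (λ c → (x + c) ∸ 1) (colLength-0 pos)) (cong (_∸ 1) (+-suc x (length L)))

firstColumn : List ℕ → List ℕ
firstColumn L = map (λ i → hookAt L i 0) (upTo (length L))

firstColumn-∷ : ∀ {x L} → All (0 <_) (x ∷ L) → firstColumn (x ∷ L) ≡ x + length L ∷ firstColumn L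
firstColumn-∷ {x} {L} pos@(x>0 ∷ _) = cong₂ _∷_ (hookAt-corner pos) (begin
  map (λ i → hookAt (x ∷ L) i 0) (applyUpTo suc (length L))  ≡⟨ map-applyUpTo suc _ (length L) ⟩
  applyUpTo (λ i → hookAt (x ∷ L) (suc i) 0) (length L)      ≡⟨ sym (map-upTo _ (length L)) ⟩
  map (λ i → hookAt (x ∷ L) (suc i) 0) (upTo (length L))     ≡⟨ map-cong (λ i → hookAt-∷ L i x>0) (upTo (length L)) ⟩
  firstColumn L ∎)
  where open ≡-Reasoning

parts≤head : ∀ {x L} → Linked _≥_ (x ∷ L) → All (_≤ x) L
parts≤head [-]         = []
parts≤head (x≥y ∷ lnk) = Linked⇒All (λ a b → ≤-trans b a) x≥y lnk

m≤n⇒m+o<n+[1+o] : ∀ {x x'} k → x' ≤ x → x' + k < x + suc k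
m≤n⇒m+o<n+[1+o] {x} {x'} k x'≤x = subst (x' + k <_) (sym (+-suc x k)) (s≤s (+-monoˡ-≤ k x'≤x))

firstColumn-below : ∀ {x L} → Linked _≥_ (x ∷ L) → All (0 <_) (x ∷ L) → All (_< x + length L) (firstColumn L)
firstColumn-below {L = []} _ _ = []
firstColumn-below {x} {x' ∷ L} (x≥x' ∷ lnk) (_ ∷ pos) =
  subst (All (_< x + length (x' ∷ L))) (sym (firstColumn-∷ pos))
    (top'<top ∷ All.map (λ y<top' → <-trans y<top' top'<top) (firstColumn-below lnk pos))
  where
    top'<top : x' + length L < x + suc (length L)
    top'<top = m≤n⇒m+o<n+[1+o] (length L) x≥x'

firstColumn-strict : ∀ {L} → Linked _≥_ L → All (0 <_) L → AllPairs _>_ (firstColumn L)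
firstColumn-strict {[]} _ _ = []
firstColumn-strict {x ∷ L} lnk pos@(_ ∷ pos') =
  subst (AllPairs _>_) (sym (firstColumn-∷ pos)) (firstColumn-below lnk pos ∷ firstColumn-strict (Linked.tail lnk) pos')

∑-gaps-above : ∀ {m h H} → All (_< m) H → m < h → (Q : ℕ → ℕ) →
               ∑[ g < h ] (gap (m ∷ H) g * Q g)
                 ≡ ∑[ g < m ] (gap (m ∷ H) g * Q g) + ∑[ t < h ∸ suc m ] Q (suc m + t)
∑-gaps-above {m} {h} {H} H<m m<h Q = begin
  ∑< h w                                              ≡⟨ ∑<-split m<h w ⟩
  ∑< (suc m) w + ∑[ t < h ∸ suc m ] w (suc m + t)     ≡⟨ cong₂ _+_ (∑<-suc m w) (∑<-cong (h ∸ suc m) w-above) ⟩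
  ∑< m w + w m + rest                                 ≡⟨ cong (λ c → ∑< m w + c + rest) w-m ⟩
  ∑< m w + 0 + rest                                   ≡⟨ cong (_+ rest) (+-identityʳ _) ⟩
  ∑< m w + rest                                       ∎
  where
    open ≡-Reasoning
    w : ℕ → ℕ
    w g = gap (m ∷ H) g * Q g
    rest = ∑[ t < h ∸ suc m ] Q (suc m + t)
    w-m : w m ≡ 0
    w-m = cong (_* Q m) (gap-∈ {m ∷ H} (here refl))
    above : ∀ t → suc m + t ∉ m ∷ H
    above t (here 1+m+t≡m)  = <⇒≢ (s≤s (m≤m+n m t)) (sym 1+m+t≡m)
    above t (there m+t∈H) = ∉-above H<m (≤-trans (n≤1+n m) (m≤m+n (suc m) t)) m+t∈H
    w-above : ∀ t → t < h ∸ suc m → w (suc m + t) ≡ Q (suc m + t)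
    w-above t _ = trans (cong (_* Q (suc m + t)) (gap-∉ (above t))) (*-identityˡ (Q (suc m + t)))

-- Cell (0, j) has hook (corner hook) ∸ columnGap j, and along the first row these values run
-- through the gaps below the corner hook (∑-columnGaps).
columnGap : List ℕ → ℕ → ℕ
columnGap L j = (j + length L) ∸ colLength L j

columnGap-∷ : ∀ {x} L {j} → j < x → columnGap (x ∷ L) j ≡ columnGap L j
columnGap-∷ L {j} j<x = trans (cong ((j + suc (length L)) ∸_) (colLength-< L j<x))
                              (cong (_∸ suc (colLength L j)) (+-suc j (length L)))

∸-slide : ∀ x j {c k} → c ≤ k → (x + c) ∸ j ≡ (x + k) ∸ ((j + k) ∸ c)
∸-slide x j {c} {k} c≤k = begin
  (x + c) ∸ j                        ≡⟨ sym ([m+n]∸[m+o]≡n∸o (k ∸ c) (x + c) j) ⟩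
  (k ∸ c + (x + c)) ∸ (k ∸ c + j)    ≡⟨ cong₂ _∸_ (trans (x∙yz≈y∙xz (k ∸ c) x c) (cong (x +_) (m∸n+n≡m c≤k)))
                                                  (+-comm (k ∸ c) j) ⟩
  (x + k) ∸ (j + (k ∸ c))            ≡⟨ cong ((x + k) ∸_) (sym (+-∸-assoc j c≤k)) ⟩
  (x + k) ∸ ((j + k) ∸ c)            ∎
  where open ≡-Reasoning

hookAt-firstRow : ∀ {x} L {j} → j < x → hookAt (x ∷ L) 0 j ≡ (x + length L) ∸ columnGap (x ∷ L) j
hookAt-firstRow {x} L {j} j<x = begin
  (x + colLength (x ∷ L) j) ∸ (j + 1)   ≡⟨ cong₂ _∸_ (cong (x +_) (colLength-< L j<x)) (+-comm j 1) ⟩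
  (x + suc (colLength L j)) ∸ suc j     ≡⟨ cong (_∸ suc j) (+-suc x (colLength L j)) ⟩
  (x + colLength L j) ∸ j               ≡⟨ ∸-slide x j (length-filter (j <?_) L) ⟩
  (x + length L) ∸ columnGap L j        ≡⟨ cong ((x + length L) ∸_) (sym (columnGap-∷ L j<x)) ⟩
  (x + length L) ∸ columnGap (x ∷ L) j  ∎
  where open ≡-Reasoning

∑-columnGaps : ∀ {x} L (Q : ℕ → ℕ) → Linked _≥_ (x ∷ L) → All (0 <_) (x ∷ L) →
               ∑[ j < x ] Q (columnGap (x ∷ L) j) ≡ ∑[ g < x + length L ] (gap (firstColumn (x ∷ L)) g * Q g)
∑-columnGaps {x} [] Q _ pos = begin
  ∑[ j < x ] Q (columnGap (x ∷ []) j)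
    ≡⟨ ∑<-cong x (λ j j<x → cong (λ c → Q ((j + 1) ∸ c)) (colLength-< [] j<x)) ⟩
  ∑[ j < x ] Q ((j + 1) ∸ 1)
    ≡⟨ ∑<-cong x (λ j _ → cong Q (m+n∸n≡m j 1)) ⟩
  ∑< x Q
    ≡⟨ cong (λ k → ∑< k Q) (sym (+-identityʳ x)) ⟩
  ∑< (x + 0) Q
    ≡⟨ ∑<-cong (x + 0) (λ g g<x → sym (trans (cong (_* Q g) (gap-∉ (g∉ g<x))) (*-identityˡ (Q g)))) ⟩
  ∑[ g < x + 0 ] (gap (firstColumn (x ∷ [])) g * Q g) ∎
  where
    open ≡-Reasoning
    g∉ : ∀ {g} → g < x + 0 → g ∉ firstColumn (x ∷ [])
    g∉ g<x (here g≡corner) = <⇒≢ g<x (trans g≡corner (hookAt-corner pos))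
∑-columnGaps {x} (x' ∷ L) Q lnk@(x≥x' ∷ lnk') pos@(_ ∷ pos') = begin
  ∑[ j < x ] Q (columnGap (x ∷ x' ∷ L) j)
    ≡⟨ ∑<-split x≥x' _ ⟩
  ∑[ j < x' ] Q (columnGap (x ∷ x' ∷ L) j) + ∑[ t < x ∸ x' ] Q (columnGap (x ∷ x' ∷ L) (x' + t))
    ≡⟨ cong₂ _+_ (∑<-cong x' (λ j j<x' → cong Q (columnGap-∷ (x' ∷ L) (<-≤-trans j<x' x≥x'))))
                 (∑<-cong (x ∸ x') (λ t t<x∸x' → cong Q (columnGap-long t t<x∸x'))) ⟩
  ∑[ j < x' ] Q (columnGap (x' ∷ L) j) + ∑[ t < x ∸ x' ] Q (suc top' + t)
    ≡⟨ cong₂ _+_ (∑-columnGaps L Q lnk' pos') (cong (λ k → ∑[ t < k ] Q (suc top' + t)) (sym top∸top'≡x∸x')) ⟩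
  ∑[ g < top' ] (gap (firstColumn (x' ∷ L)) g * Q g) + ∑[ t < top ∸ suc top' ] Q (suc top' + t)
    ≡⟨ cong (λ K → ∑[ g < top' ] (gap K g * Q g) + ∑[ t < top ∸ suc top' ] Q (suc top' + t)) (firstColumn-∷ pos') ⟩
  ∑[ g < top' ] (gap (top' ∷ H) g * Q g) + ∑[ t < top ∸ suc top' ] Q (suc top' + t)
    ≡⟨ sym (∑-gaps-above (firstColumn-below lnk' pos') top'<top Q) ⟩
  ∑[ g < top ] (gap (top' ∷ H) g * Q g)
    ≡⟨ ∑<-cong top (λ g g<top → cong (_* Q g) (sym (gap-∷ (<⇒≢ g<top)))) ⟩
  ∑[ g < top ] (gap (top ∷ top' ∷ H) g * Q g)
    ≡⟨ cong (λ K → ∑[ g < top ] (gap K g * Q g))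
            (sym (trans (firstColumn-∷ pos) (cong (top ∷_) (firstColumn-∷ pos')))) ⟩
  ∑[ g < top ] (gap (firstColumn (x ∷ x' ∷ L)) g * Q g) ∎
  where
    open ≡-Reasoning
    top' = x' + length L
    top = x + length (x' ∷ L)
    H = firstColumn L
    top'<top : top' < top
    top'<top = m≤n⇒m+o<n+[1+o] (length L) x≥x'
    top∸top'≡x∸x' : top ∸ suc top' ≡ x ∸ x'
    top∸top'≡x∸x' = trans (cong (_∸ suc top') (+-suc x (length L)))
      (trans (cong₂ _∸_ (+-comm x (length L)) (+-comm x' (length L))) ([m+n]∸[m+o]≡n∸o (length L) x x'))
    columnGap-long : ∀ t → t < x ∸ x' → columnGap (x ∷ x' ∷ L) (x' + t) ≡ suc top' + t
    columnGap-long t t<x∸x' = begin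
      (x' + t + suc (suc (length L))) ∸ colLength (x ∷ x' ∷ L) (x' + t)
        ≡⟨ cong ((x' + t + suc (suc (length L))) ∸_)
                (trans (colLength-< (x' ∷ L) x'+t<x) (cong suc (colLength-≥ x'L≤x'+t))) ⟩
      (x' + t + suc (suc (length L))) ∸ 1
        ≡⟨ cong (_∸ 1) (+-suc (x' + t) (suc (length L))) ⟩
      x' + t + suc (length L)
        ≡⟨ +-suc (x' + t) (length L) ⟩
      suc (x' + t + length L)
        ≡⟨ cong suc (xy∙z≈xz∙y x' t (length L)) ⟩
      suc top' + t ∎
      where
        x'+t<x : x' + t < x
        x'+t<x = subst (x' + t <_) (m+[n∸m]≡n x≥x') (+-monoʳ-< x' t<x∸x')
        x'L≤x'+t : All (_≤ x' + t) (x' ∷ L)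
        x'L≤x'+t = m≤m+n x' t ∷ All.map (λ y≤x' → ≤-trans y≤x' (m≤m+n x' t)) (parts≤head lnk')

nth-≤ : ∀ {x} L i → All (_≤ x) L → nth L i ≤ x
nth-≤ []      i       []        = z≤n
nth-≤ (_ ∷ _) zero    (y≤x ∷ _) = y≤x
nth-≤ (_ ∷ L) (suc i) (_ ∷ L≤x) = nth-≤ L i L≤x

hookAt-0∈firstColumn : ∀ L {i} → i < length L → hookAt L i 0 ∈ firstColumn L
hookAt-0∈firstColumn L i<len = ∈-map⁺ (λ i → hookAt L i 0) (∈-upTo⁺ i<len)

∑-rowHooks : ∀ L (Q : ℕ → ℕ) {i} → Linked _≥_ L → All (0 <_) L → i < length L →
             ∑[ j < nth L i ] Q (hookAt L i j)
               ≡ ∑[ g < hookAt L i 0 ] (gap (firstColumn L) g * Q (hookAt L i 0 ∸ g))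
∑-rowHooks (x ∷ L) Q {zero} lnk pos _ = begin
  ∑[ j < x ] Q (hookAt (x ∷ L) 0 j)
    ≡⟨ ∑<-cong x (λ j j<x → cong Q (hookAt-firstRow L j<x)) ⟩
  ∑[ j < x ] Q ((x + length L) ∸ columnGap (x ∷ L) j)
    ≡⟨ ∑-columnGaps L (λ g → Q ((x + length L) ∸ g)) lnk pos ⟩
  ∑[ g < x + length L ] (gap (firstColumn (x ∷ L)) g * Q ((x + length L) ∸ g))
    ≡⟨ cong (λ h → ∑[ g < h ] (gap (firstColumn (x ∷ L)) g * Q (h ∸ g))) (sym (hookAt-corner pos)) ⟩
  ∑[ g < hookAt (x ∷ L) 0 0 ] (gap (firstColumn (x ∷ L)) g * Q (hookAt (x ∷ L) 0 0 ∸ g)) ∎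
  where open ≡-Reasoning
∑-rowHooks (x ∷ L) Q {suc i} lnk pos@(x>0 ∷ pos') (s≤s i<len) = begin
  ∑[ j < nth L i ] Q (hookAt (x ∷ L) (suc i) j)
    ≡⟨ ∑<-cong (nth L i) (λ j j<λᵢ → cong Q (hookAt-∷ L i (<-≤-trans j<λᵢ (nth-≤ L i (parts≤head lnk))))) ⟩
  ∑[ j < nth L i ] Q (hookAt L i j)
    ≡⟨ ∑-rowHooks L Q (Linked.tail lnk) pos' i<len ⟩
  ∑[ g < y ] (gap (firstColumn L) g * Q (y ∸ g))
    ≡⟨ ∑<-cong y (λ g g<y → cong (_* Q (y ∸ g)) (sym (gap-∷ (<⇒≢ (<-trans g<y y<corner))))) ⟩
  ∑[ g < y ] (gap (x + length L ∷ firstColumn L) g * Q (y ∸ g))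
    ≡⟨ cong (λ K → ∑[ g < y ] (gap K g * Q (y ∸ g))) (sym (firstColumn-∷ pos)) ⟩
  ∑[ g < y ] (gap (firstColumn (x ∷ L)) g * Q (y ∸ g))
    ≡⟨ cong (λ h → ∑[ g < h ] (gap (firstColumn (x ∷ L)) g * Q (h ∸ g))) (sym (hookAt-∷ L i x>0)) ⟩
  ∑[ g < hookAt (x ∷ L) (suc i) 0 ] (gap (firstColumn (x ∷ L)) g * Q (hookAt (x ∷ L) (suc i) 0 ∸ g)) ∎
  where
    open ≡-Reasoning
    y = hookAt L i 0
    y<corner : y < x + length L
    y<corner = All.lookup (firstColumn-below lnk pos) (hookAt-0∈firstColumn L i<len)

nth-∈ : ∀ L {i} → i < length L → nth L i ∈ L
nth-∈ (x ∷ L) {zero}  _           = here refl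
nth-∈ (x ∷ L) {suc i} (s≤s i<len) = there (nth-∈ L i<len)

hook∈hooks : ∀ κ {i j} → i < length (parts κ) → j < part κ i → hook κ i j ∈ hooks κ
hook∈hooks κ {i} {j} i<len j<λᵢ = ∈-map⁺ (λ c → hook κ (proj₁ c) (proj₂ c))
  (∈-concatMap⁺ (λ i → map (i ,_) (upTo (part κ i)))
    (Any.map (λ { refl → ∈-map⁺ (i ,_) (∈-upTo⁺ j<λᵢ) }) (∈-upTo⁺ i<len)))

gap⇒hook : ∀ κ {i g} → i < length (parts κ) → g < hook κ i 0 → g ∉ firstColHooks κ →
           hook κ i 0 ∸ g ∈ hooks κ
gap⇒hook κ {i} {g} i<len g<y g∉H =
  let j , j<λᵢ , hit = ∑<-positive⇒term (part κ i) (λ j → Q (hook κ i j)) row-count>0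
  in subst (_∈ hooks κ) (𝟙-positive (hook κ i j ≟ y ∸ g) hit) (hook∈hooks κ i<len j<λᵢ)
  where
    y = hook κ i 0
    Q : ℕ → ℕ
    Q v = 𝟙 (v ≟ y ∸ g)
    row-count>0 : 0 < ∑[ j < part κ i ] Q (hook κ i j)
    row-count>0 = subst (0 <_) (sym (∑-rowHooks (parts κ) Q (decreasing κ) (positive κ) i<len))
      (≤-trans (≤-reflexive (sym (cong₂ _*_ (gap-∉ g∉H) (𝟙-yes (y ∸ g ≟ y ∸ g) refl))))
               (term≤∑< y (λ g → gap (firstColHooks κ) g * Q (y ∸ g)) g<y))

core⇒IsCoreSet : ∀ {n} κ → 0 < n → n ∉ hooks κ → IsCoreSet n (firstColHooks κ)
core⇒IsCoreSet {n} κ n>0 n∉hooks y∈H with ∈-map⁻ (λ i → hook κ i 0) y∈H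
... | i , i∈upTo , refl = y≢n , closed
  where
    L = parts κ
    i<len = ∈-upTo⁻ i∈upTo
    y≢n : hook κ i 0 ≢ n
    y≢n y≡n = n∉hooks (subst (_∈ hooks κ) y≡n (hook∈hooks κ i<len (All.lookup (positive κ) (nth-∈ L i<len))))
    closed : n < hook κ i 0 → hook κ i 0 ∸ n ∈ firstColHooks κ
    closed n<y with hook κ i 0 ∸ n ∈? firstColHooks κ
    ... | yes y∸n∈H = y∸n∈H
    ... | no  y∸n∉H = ⊥-elim (n∉hooks (subst (_∈ hooks κ) (m∸[m∸n]≡n (<⇒≤ n<y))
                        (gap⇒hook κ i<len (∸-monoʳ-< n>0 (<⇒≤ n<y)) y∸n∉H)))

skewLength≡betaSkew : ∀ n p κ → skewLength n p κ ≡ betaSkew n p (firstColHooks κ)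
skewLength≡betaSkew n p κ = begin
  skewLength n p κ
    ≡⟨ length-filter-concatMap P? row (λ i → i) (length L) ⟩
  ∑[ i < length L ] length (filter P? (row i))
    ≡⟨ ∑<-cong (length L) rowCount ⟩
  ∑[ i < length L ] F (hook κ i 0)
    ≡⟨ sym (∑∈-applyUpTo F (λ i → hook κ i 0) (length L)) ⟩
  ∑∈ (applyUpTo (λ i → hook κ i 0) (length L)) F
    ≡⟨ cong (λ ys → ∑∈ ys F) (sym (map-upTo (λ i → hook κ i 0) (length L))) ⟩
  betaSkew n p (firstColHooks κ) ∎
  where
    open ≡-Reasoning
    L = parts κ
    H = firstColHooks κ
    P? = λ (c : ℕ × ℕ) → isRow? n κ (proj₁ c) ×-dec (hook κ (proj₁ c) (proj₂ c) <? p)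
    row : ℕ → List (ℕ × ℕ)
    row i = map (i ,_) (upTo (part κ i))
    F : ℕ → ℕ
    F y = gap H (y + n) * shortHooks p H y
    rowCount : ∀ i → i < length L → length (filter P? (row i)) ≡ F (hook κ i 0)
    rowCount i i<len = begin
      length (filter P? (row i))
        ≡⟨ cong (length ∘ filter P?) (map-upTo (i ,_) (part κ i)) ⟩
      length (filter P? (applyUpTo (i ,_) (part κ i)))
        ≡⟨ length-filter-applyUpTo P? (i ,_) (part κ i) ⟩
      ∑[ j < part κ i ] 𝟙 (P? (i , j))
        ≡⟨ ∑<-cong (part κ i) (λ j _ → 𝟙-× (isRow? n κ i) (hook κ i j <? p)) ⟩
      ∑[ j < part κ i ] (𝟙 (isRow? n κ i) * 𝟙 (hook κ i j <? p))
        ≡⟨ ∑<-*ˡ (𝟙 (isRow? n κ i)) (part κ i) (λ j → 𝟙 (hook κ i j <? p)) ⟩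
      𝟙 (isRow? n κ i) * ∑[ j < part κ i ] 𝟙 (hook κ i j <? p)
        ≡⟨ cong (𝟙 (isRow? n κ i) *_) (∑-rowHooks L (λ v → 𝟙 (v <? p)) (decreasing κ) (positive κ) i<len) ⟩
      F (hook κ i 0) ∎

corollary1p5 : (n p : ℕ) → 0 < n → 0 < p → (κ : Partition) → IsCore n p κ →
               skewLength n p κ ≡ skewLength p n κ
corollary1p5 n p n>0 p>0 κ (n∉hooks , p∉hooks) = begin
  skewLength n p κ                  ≡⟨ skewLength≡betaSkew n p κ ⟩
  betaSkew n p (firstColHooks κ)    ≡⟨ betaSkew-sym n p n>0 p>0 (firstColumn-strict (decreasing κ) (positive κ))
                                         (core⇒IsCoreSet κ n>0 n∉hooks) (core⇒IsCoreSet κ p>0 p∉hooks) ⟩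
  betaSkew p n (firstColHooks κ)    ≡⟨ sym (skewLength≡betaSkew p n κ) ⟩
  skewLength p n κ                  ∎
  where open ≡-Reasoning
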